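{- Let $m,n$ be positive integers, $N=mn$, and let $\mathrm{Break}_{m,n}$ be the set of break divisors on the complete multigraph $K_n^m$. Let $\Lambda_n$ be the set of partitions $\lambda=(\lambda_1\ge\cdots\ge\lambda_n\ge0)$ in $\mathbb{N}^n$. For $\mathbf x\in\{0,\dots,N-1\}^n$ let $\mathrm{shift}(\mathbf x)=(x_1+m,\dots,x_n+m)$ with entries reduced modulo $N$ into $\{0,\dots,N-1\}$, and let $\mathrm{sort}(\mathbf x)$ be the partition obtained by sorting $\mathbf x$ into nonincreasing order. If $\lambda\in\Lambda_n\cap\mathrm{Break}_{m,n}$, then no element of the set $\{\mathrm{sort}(\mathrm{shift}^j(\lambda)) : 1\le j\le n-1\}$ belongs to $\Lambda_n\cap\mathrm{Break}_{m,n}$.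
   Context: $K_n^m$ is the complete multigraph on vertex set $[n]$ with exactly $m$ edges between each pair of distinct vertices. For a graph $H$, $g(H)=|E(H)|-|V(H)|+1$; $g(K_n^m)=m\binom n2-n+1$. A divisor is a vector $D\in\mathbb{Z}^n$ (indexed by vertices). A break divisor on $K_n^m$ is a divisor $D$ with all entries $\ge0$, entry sum $g(K_n^m)$, and $\sum_{v\in V(H)}D(v)\ge g(H)$ for every induced subgraph $H$ of $K_n^m$. (Every element of $\mathrm{Break}_{m,n}$ has entries in $\{0,\dots,N-1\}$, so the shift is defined on it.) -}

module Defs where

open import Data.Nat as ℕ using (ℕ; zero; suc; _+_; _*_; _≥_; NonZero)
open import Data.Nat.Properties using (m*n≢0)
open import Data.Nat.DivMod using (_%_)
open import Data.Nat.Combinatorics using (_C_)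
open import Data.Integer as ℤ using (ℤ; +_)
open import Data.Fin using (Fin; zero; suc)
open import Data.Fin.Subset using (Subset; _∈_; ∣_∣; Nonempty)
open import Data.Vec using (Vec; []; _∷_)
open import Data.Bool using (true; false)
open import Data.Product using (Σ)
open import Function.Bundles using (_↔_; Inverse)
open import Relation.Binary.PropositionalEquality using (_≡_)

Divisor : ℕ → Set
Divisor n = Fin n → ℤ

total : ∀ {n} → Divisor n → ℤ
total {zero}  D = + 0
total {suc n} D = D zero ℤ.+ total (λ i → D (suc i))

sumOver : ∀ {n} → Subset n → Divisor n → ℤ
sumOver {zero}  []          D = + 0
sumOver {suc n} (true  ∷ S) D = D zero ℤ.+ sumOver S (λ i → D (suc i))
sumOver {suc n} (false ∷ S) D = sumOver S (λ i → D (suc i))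

-- g(H) = |E(H)| - |V(H)| + 1 for the subgraph of K_n^m induced on k vertices:
-- it has m * (k choose 2) edges.
genusInduced : ℕ → ℕ → ℤ
genusInduced m k = + (m * (k C 2)) ℤ.- + k ℤ.+ + 1

genusK : ℕ → ℕ → ℤ
genusK m n = genusInduced m n

-- Break divisor on K_n^m. Induced subgraphs are those on nonempty vertex sets S.
record IsBreak (m n : ℕ) (D : Divisor n) : Set where
  field
    nonneg  : ∀ i → D i ℤ.≥ + 0
    degree  : total D ≡ genusK m n
    induced : ∀ (S : Subset n) → Nonempty S → sumOver S D ℤ.≥ genusInduced m ∣ S ∣

toDivisor : ∀ {n} → (Fin n → ℕ) → Divisor n
toDivisor x i = + x i

IsPartition : ∀ {n} → (Fin n → ℕ) → Set
IsPartition {n} x = ∀ (i j : Fin n) → i Data.Fin.≤ j → x i ≥ x j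

shift : (m n : ℕ) → .{{NonZero m}} → .{{NonZero n}} → (Fin n → ℕ) → (Fin n → ℕ)
shift m n x i = _%_ (x i + m) (m * n) {{m*n≢0 m n}}

shiftIter : (m n : ℕ) → .{{NonZero m}} → .{{NonZero n}} → ℕ → (Fin n → ℕ) → (Fin n → ℕ)
shiftIter m n zero    x = x
shiftIter m n (suc j) x = shift m n (shiftIter m n j x)

-- y = sort(x): y is nonincreasing and a rearrangement of x
-- (this determines sort(x) uniquely).
IsSortOf : ∀ {n} → (Fin n → ℕ) → (Fin n → ℕ) → Set
IsSortOf {n} y x = IsPartition y × Σ (Fin n ↔ Fin n) (λ σ → ∀ i → y i ≡ x (Inverse.to σ i))
  where open import Data.Product using (_×_)

-- Write c = j m, so that the shifted vector is z_k = (λ_k + c) mod N.  A break divisor has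
-- entries at most m (n - 1) - 1 < N, hence every entry of λ either stays (z_k = λ_k + c) or
-- wraps exactly once (z_k = λ_k + c - N), and as λ is nonincreasing the wrapped entries form
-- an initial segment.  Since a rearrangement of a break divisor is a break divisor, it is
-- enough to show that z is not a break divisor.  Let p be the j-th vertex.
--   * If λ_p does not wrap, at most j - 1 entries wrap, so deg z ≥ deg λ + n c - (j - 1) N
--     = deg λ + N, and z has the wrong degree.
--   * If λ_p wraps, so do the first j entries, and the break inequality of λ on the other
--     n - j vertices bounds their sum in z by g(K_n) - g(K_(n-j)) + j c - j N = g(K_j) - 1,
--     violating the break inequality of z on those j vertices.

module Submission where

open import Defs
open import Data.Nat using (ℕ; NonZero; _≤_; _<_)
open import Data.Fin using (Fin)
open import Relation.Nullary using (¬_)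
open import Data.Product using (_×_)

open import Data.Nat as ℕ using (zero; suc; z≤n; s≤s)
open import Data.Nat.DivMod using (_%_; %-distribˡ-+; m%n%n≡m%n; m<n⇒m%n≡m; [m+n]%n≡m%n)
import Data.Nat.Properties as ℕP
open import Data.Nat.Combinatorics using (_C_; nC1≡n; nCk+nC[k+1]≡[n+1]C[k+1])
import Data.Nat.Tactic.RingSolver as ℕ-Ring
open import Data.Integer as ℤ using (ℤ; +_)
import Data.Integer.Properties as ℤP
open import Data.Integer.Tactic.RingSolver using (solve-∀)
open import Data.Fin using (zero; suc; toℕ; fromℕ<)
open import Data.Fin.Properties using (toℕ<n; toℕ-fromℕ<)
open import Data.Fin.Subset using (Subset; _∈_; ∣_∣; Nonempty; ∁; ⁅_⁆; ⊥; inside; outside)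
open import Data.Fin.Subset.Properties using (∣∁p∣≡n∸∣p∣; ∣⁅x⁆∣≡1; x∈∁p⇒x∉p; ∣p∣≤n)
open import Relation.Nullary using (contradiction; yes; no)
open import Data.Vec using ([]; _∷_; here; there; lookup; tabulate)
open import Data.Vec.Properties using (lookup∘tabulate; lookup⇒[]=; []=⇒lookup)
open import Data.Bool using (if_then_else_)
open import Data.Product using (_,_)
open import Function.Base using (_∘_)
open import Function.Bundles using (_↔_; Inverse)
open import Relation.Binary.PropositionalEquality
open import Algebra.Properties.CommutativeSemigroup ℤP.+-commutativeSemigroup
  using (interchange; x∙yz≈y∙xz; xy∙z≈y∙xz)
open import Algebra.Properties.CommutativeMonoid.Sum ℤP.+-0-commutativeMonoid
  using (sum; sum-cong-≗; sum-permute)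

private
  variable
    n : ℕ

+-cancelˡ-≤ : ∀ k {i j} → k ℤ.+ i ℤ.≤ k ℤ.+ j → i ℤ.≤ j
+-cancelˡ-≤ k {i} {j} k+i≤k+j = subst₂ ℤ._≤_ (cancel k i) (cancel k j) (ℤP.+-monoʳ-≤ (ℤ.- k) k+i≤k+j)
  where
  cancel : ∀ k x → ℤ.- k ℤ.+ (k ℤ.+ x) ≡ x
  cancel = solve-∀

[m%d+n]%d≡[m+n]%d : ∀ a b d .{{_ : NonZero d}} → (a % d ℕ.+ b) % d ≡ (a ℕ.+ b) % d
[m%d+n]%d≡[m+n]%d a b d = begin
  (a % d ℕ.+ b) % d            ≡⟨ %-distribˡ-+ (a % d) b d ⟩
  (a % d % d ℕ.+ b % d) % d    ≡⟨ cong (λ x → (x ℕ.+ b % d) % d) (m%n%n≡m%n a d) ⟩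
  (a % d ℕ.+ b % d) % d        ≡⟨ %-distribˡ-+ a b d ⟨
  (a ℕ.+ b) % d                ∎
  where open ≡-Reasoning

m%d+d≡m : ∀ {a d} .{{_ : NonZero d}} → d ≤ a → a < d ℕ.+ d → a % d ℕ.+ d ≡ a
m%d+d≡m {a} {d} d≤a a<2d = begin
  a % d ℕ.+ d                 ≡⟨ cong (λ x → x % d ℕ.+ d) (ℕP.m∸n+n≡m d≤a) ⟨
  ((a ℕ.∸ d) ℕ.+ d) % d ℕ.+ d ≡⟨ cong (ℕ._+ d) ([m+n]%n≡m%n (a ℕ.∸ d) d) ⟩
  (a ℕ.∸ d) % d ℕ.+ d         ≡⟨ cong (ℕ._+ d) (m<n⇒m%n≡m a∸d<d) ⟩
  (a ℕ.∸ d) ℕ.+ d             ≡⟨ ℕP.m∸n+n≡m d≤a ⟩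
  a                           ∎
  where
  open ≡-Reasoning
  a∸d<d : a ℕ.∸ d < d
  a∸d<d = ℕP.+-cancelʳ-< d (a ℕ.∸ d) d (subst (_< d ℕ.+ d) (sym (ℕP.m∸n+n≡m d≤a)) a<2d)

m≤m%d+d : ∀ {a d} .{{_ : NonZero d}} → a < d ℕ.+ d → a ≤ a % d ℕ.+ d
m≤m%d+d {a} {d} a<2d with a ℕ.<? d
... | yes a<d = subst (_≤ a % d ℕ.+ d) (m<n⇒m%n≡m a<d) (ℕP.m≤m+n (a % d) d)
... | no  a≮d = ℕP.≤-reflexive (sym (m%d+d≡m (ℕP.≮⇒≥ a≮d) a<2d))

0<∣p∣⇒Nonempty : {p : Subset n} → 0 < ∣ p ∣ → Nonempty p
0<∣p∣⇒Nonempty {p = inside  ∷ p} _     = zero , here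
0<∣p∣⇒Nonempty {p = outside ∷ p} 0<∣p∣ with i , i∈p ← 0<∣p∣⇒Nonempty 0<∣p∣ = suc i , there i∈p

∣p∣+∣∁p∣≡n : (S : Subset n) → ∣ S ∣ ℕ.+ ∣ ∁ S ∣ ≡ n
∣p∣+∣∁p∣≡n S = trans (cong (∣ S ∣ ℕ.+_) (∣∁p∣≡n∸∣p∣ S)) (ℕP.m+[n∸m]≡n (∣p∣≤n S))

prefix : ℕ → Subset n
prefix {zero}  _       = []
prefix {suc n} zero    = outside ∷ prefix zero
prefix {suc n} (suc t) = inside ∷ prefix t

∣prefix∣ : (t : ℕ) → t ≤ n → ∣ prefix {n} t ∣ ≡ t
∣prefix∣ {zero}  zero    z≤n       = refl
∣prefix∣ {suc n} zero    z≤n       = ∣prefix∣ {n} zero z≤n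
∣prefix∣ {suc n} (suc t) (s≤s t≤n) = cong suc (∣prefix∣ t t≤n)

∈prefix⇒< : {t : ℕ} {i : Fin n} → i ∈ prefix t → toℕ i < t
∈prefix⇒< {t = zero}  (there i∈p) = contradiction (∈prefix⇒< i∈p) λ ()
∈prefix⇒< {t = suc t} here        = s≤s z≤n
∈prefix⇒< {t = suc t} (there i∈p) = s≤s (∈prefix⇒< i∈p)

<⇒∈prefix : {t : ℕ} {i : Fin n} → toℕ i < t → i ∈ prefix t
<⇒∈prefix {suc n} {suc t} {zero}  _         = here
<⇒∈prefix {suc n} {suc t} {suc i} (s≤s i<t) = there (<⇒∈prefix i<t)

∈∁prefix⇒≥ : {t : ℕ} {i : Fin n} → i ∈ ∁ (prefix t) → t ≤ toℕ i
∈∁prefix⇒≥ i∈∁p = ℕP.≮⇒≥ (x∈∁p⇒x∉p i∈∁p ∘ <⇒∈prefix)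

preimage : {m : ℕ} → (Fin m → Fin n) → Subset n → Subset m
preimage f S = tabulate (lookup S ∘ f)

∈-preimage : {m : ℕ} (f : Fin m → Fin n) {S : Subset n} {i : Fin m} → f i ∈ S → i ∈ preimage f S
∈-preimage f {S} {i} fi∈S = lookup⇒[]= i _ (trans (lookup∘tabulate (lookup S ∘ f) i) ([]=⇒lookup fi∈S))

sumOver-cong : (S : Subset n) {D E : Divisor n} →
               (∀ {i} → i ∈ S → D i ≡ E i) → sumOver S D ≡ sumOver S E
sumOver-cong []          D≡E = refl
sumOver-cong (inside  ∷ S) D≡E = cong₂ ℤ._+_ (D≡E here) (sumOver-cong S (D≡E ∘ there))
sumOver-cong (outside ∷ S) D≡E = sumOver-cong S (D≡E ∘ there)

sumOver-mono : (S : Subset n) {D E : Divisor n} →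
               (∀ {i} → i ∈ S → D i ℤ.≤ E i) → sumOver S D ℤ.≤ sumOver S E
sumOver-mono []          D≤E = ℤP.≤-refl
sumOver-mono (inside  ∷ S) D≤E = ℤP.+-mono-≤ (D≤E here) (sumOver-mono S (D≤E ∘ there))
sumOver-mono (outside ∷ S) D≤E = sumOver-mono S (D≤E ∘ there)

sumOver-+ : (S : Subset n) (D E : Divisor n) →
            sumOver S (λ i → D i ℤ.+ E i) ≡ sumOver S D ℤ.+ sumOver S E
sumOver-+ []          D E = refl
sumOver-+ (inside  ∷ S) D E =
  trans (cong (ℤ._+_ (D zero ℤ.+ E zero)) (sumOver-+ S (D ∘ suc) (E ∘ suc)))
        (interchange (D zero) (E zero) _ _)
sumOver-+ (outside ∷ S) D E = sumOver-+ S (D ∘ suc) (E ∘ suc)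

sumOver-const : (S : Subset n) (c : ℤ) → sumOver S (λ _ → c) ≡ + ∣ S ∣ ℤ.* c
sumOver-const []          c = refl
sumOver-const (inside  ∷ S) c =
  trans (cong (ℤ._+_ c) (sumOver-const S c)) (sym (ℤP.suc-* (+ ∣ S ∣) c))
sumOver-const (outside ∷ S) c = sumOver-const S c

sumOver-+-const : (S : Subset n) (D : Divisor n) (c : ℤ) →
                  sumOver S (λ i → D i ℤ.+ c) ≡ sumOver S D ℤ.+ + ∣ S ∣ ℤ.* c
sumOver-+-const S D c = trans (sumOver-+ S D (λ _ → c)) (cong (ℤ._+_ (sumOver S D)) (sumOver-const S c))

sumOver-∁ : (S : Subset n) (D : Divisor n) → sumOver S D ℤ.+ sumOver (∁ S) D ≡ total D
sumOver-∁ []          D = refl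
sumOver-∁ (inside  ∷ S) D =
  trans (ℤP.+-assoc (D zero) _ _) (cong (ℤ._+_ (D zero)) (sumOver-∁ S (D ∘ suc)))
sumOver-∁ (outside ∷ S) D =
  trans (x∙yz≈y∙xz (sumOver S (D ∘ suc)) (D zero) _) (cong (ℤ._+_ (D zero)) (sumOver-∁ S (D ∘ suc)))

sumOver-⊥ : (D : Divisor n) → sumOver ⊥ D ≡ + 0
sumOver-⊥ {zero}  D = refl
sumOver-⊥ {suc n} D = sumOver-⊥ (D ∘ suc)

sumOver-⁅⁆ : (i : Fin n) (D : Divisor n) → sumOver ⁅ i ⁆ D ≡ D i
sumOver-⁅⁆ zero    D = trans (cong (ℤ._+_ (D zero)) (sumOver-⊥ (D ∘ suc))) (ℤP.+-identityʳ (D zero))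
sumOver-⁅⁆ (suc i) D = sumOver-⁅⁆ i (D ∘ suc)

total≡sum : (D : Divisor n) → total D ≡ sum D
total≡sum {zero}  D = refl
total≡sum {suc n} D = cong (ℤ._+_ (D zero)) (total≡sum (D ∘ suc))

sumOver≡sum : (S : Subset n) (D : Divisor n) →
              sumOver S D ≡ sum (λ i → if lookup S i then D i else + 0)
sumOver≡sum []          D = refl
sumOver≡sum (inside  ∷ S) D = cong (ℤ._+_ (D zero)) (sumOver≡sum S (D ∘ suc))
sumOver≡sum (outside ∷ S) D = trans (sumOver≡sum S (D ∘ suc)) (sym (ℤP.+-identityˡ _))

module _ (σ : Fin n ↔ Fin n) {D E : Divisor n} (E≗D∘σ : ∀ i → E i ≡ D (Inverse.to σ i)) where
  open Inverse σ using (to)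

  total-rearrange : total E ≡ total D
  total-rearrange = begin
    total E          ≡⟨ total≡sum E ⟩
    sum E            ≡⟨ sum-cong-≗ E≗D∘σ ⟩
    sum (D ∘ to)     ≡⟨ sum-permute D σ ⟨
    sum D            ≡⟨ total≡sum D ⟨
    total D          ∎
    where open ≡-Reasoning

  sumOver-preimage : (S : Subset n) → sumOver (preimage to S) E ≡ sumOver S D
  sumOver-preimage S = begin
    sumOver (preimage to S) E ≡⟨ sumOver≡sum (preimage to S) E ⟩
    sum (λ i → if lookup (preimage to S) i then E i else + 0)
      ≡⟨ sum-cong-≗ (λ i → cong₂ (if_then_else + 0) (lookup∘tabulate (lookup S ∘ to) i) (E≗D∘σ i)) ⟩
    sum (λ i → if lookup S (to i) then D (to i) else + 0)
      ≡⟨ sum-permute (λ k → if lookup S k then D k else + 0) σ ⟨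
    sum (λ k → if lookup S k then D k else + 0) ≡⟨ sumOver≡sum S D ⟨
    sumOver S D ∎
    where open ≡-Reasoning

∣preimage∣ : (σ : Fin n ↔ Fin n) (S : Subset n) → ∣ preimage (Inverse.to σ) S ∣ ≡ ∣ S ∣
∣preimage∣ σ S = ℤP.+-injective (begin
  + ∣ preimage (Inverse.to σ) S ∣              ≡⟨ ℤP.*-identityʳ _ ⟨
  + ∣ preimage (Inverse.to σ) S ∣ ℤ.* + 1       ≡⟨ sumOver-const (preimage (Inverse.to σ) S) (+ 1) ⟨
  sumOver (preimage (Inverse.to σ) S) (λ _ → + 1) ≡⟨ sumOver-preimage σ (λ _ → refl) S ⟩
  sumOver S (λ _ → + 1)                          ≡⟨ sumOver-const S (+ 1) ⟩
  + ∣ S ∣ ℤ.* + 1                                ≡⟨ ℤP.*-identityʳ _ ⟩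
  + ∣ S ∣                                        ∎)
  where open ≡-Reasoning

IsBreak-rearrange : {m : ℕ} (σ : Fin n ↔ Fin n) {D E : Divisor n} →
                    (∀ i → E i ≡ D (Inverse.to σ i)) → IsBreak m n E → IsBreak m n D
IsBreak-rearrange {m = m} σ {D} {E} E≗D∘σ E-break = record
  { nonneg  = λ k → subst (ℤ._≥ + 0) (trans (E≗D∘σ (from k)) (cong D (strictlyInverseˡ k))) (nonneg (from k))
  ; degree  = trans (sym (total-rearrange σ E≗D∘σ)) degree
  ; induced = λ S (i , i∈S) →
      subst₂ (λ s t → t ℤ.≥ genusInduced m s) (∣preimage∣ σ S) (sumOver-preimage σ E≗D∘σ S)
        (induced (preimage to S) (from i , ∈-preimage to (subst (_∈ S) (sym (strictlyInverseˡ i)) i∈S)))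
  }
  where
  open Inverse σ using (to; from; strictlyInverseˡ)
  open IsBreak E-break

C2-suc : ∀ k → suc k C 2 ≡ k C 2 ℕ.+ k
C2-suc k = begin
  suc k C 2         ≡⟨ nCk+nC[k+1]≡[n+1]C[k+1] k 1 ⟨
  k C 1 ℕ.+ k C 2   ≡⟨ cong (ℕ._+ k C 2) (nC1≡n k) ⟩
  k ℕ.+ k C 2       ≡⟨ ℕP.+-comm k _ ⟩
  k C 2 ℕ.+ k       ∎
  where open ≡-Reasoning

C2-+ : ∀ s t → (s ℕ.+ t) C 2 ≡ s C 2 ℕ.+ t C 2 ℕ.+ s ℕ.* t
C2-+ zero    t = sym (ℕP.+-identityʳ (t C 2))
C2-+ (suc s) t = begin
  suc (s ℕ.+ t) C 2                               ≡⟨ C2-suc (s ℕ.+ t) ⟩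
  (s ℕ.+ t) C 2 ℕ.+ (s ℕ.+ t)                     ≡⟨ cong (ℕ._+ (s ℕ.+ t)) (C2-+ s t) ⟩
  s C 2 ℕ.+ t C 2 ℕ.+ s ℕ.* t ℕ.+ (s ℕ.+ t)       ≡⟨ regroup (s C 2) (t C 2) s t ⟩
  (s C 2 ℕ.+ s) ℕ.+ t C 2 ℕ.+ suc s ℕ.* t         ≡⟨ cong (λ x → x ℕ.+ t C 2 ℕ.+ suc s ℕ.* t) (C2-suc s) ⟨
  suc s C 2 ℕ.+ t C 2 ℕ.+ suc s ℕ.* t             ∎
  where
  open ≡-Reasoning
  regroup : ∀ a b s t → a ℕ.+ b ℕ.+ s ℕ.* t ℕ.+ (s ℕ.+ t) ≡ (a ℕ.+ s) ℕ.+ b ℕ.+ suc s ℕ.* t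
  regroup = ℕ-Ring.solve-∀

genusInduced-+ : ∀ m s t → genusInduced m (s ℕ.+ t) ℤ.+ + 1 ≡
                 genusInduced m s ℤ.+ genusInduced m t ℤ.+ + (m ℕ.* (s ℕ.* t))
genusInduced-+ m s t = begin
  + (m ℕ.* ((s ℕ.+ t) C 2)) ℤ.- + (s ℕ.+ t) ℤ.+ + 1 ℤ.+ + 1
    ≡⟨ cong (λ x → + x ℤ.- + (s ℕ.+ t) ℤ.+ + 1 ℤ.+ + 1) m[s+t]C2 ⟩
  (+ a ℤ.+ + b ℤ.+ + c) ℤ.- (+ s ℤ.+ + t) ℤ.+ + 1 ℤ.+ + 1
    ≡⟨ regroup (+ a) (+ b) (+ c) (+ s) (+ t) ⟩
  (+ a ℤ.- + s ℤ.+ + 1) ℤ.+ (+ b ℤ.- + t ℤ.+ + 1) ℤ.+ + c ∎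
  where
  open ≡-Reasoning
  a = m ℕ.* (s C 2)
  b = m ℕ.* (t C 2)
  c = m ℕ.* (s ℕ.* t)
  m[s+t]C2 : m ℕ.* ((s ℕ.+ t) C 2) ≡ a ℕ.+ b ℕ.+ c
  m[s+t]C2 = trans (cong (m ℕ.*_) (C2-+ s t))
    (trans (ℕP.*-distribˡ-+ m _ _) (cong (ℕ._+ c) (ℕP.*-distribˡ-+ m _ _)))
  regroup : ∀ A B C S T → (A ℤ.+ B ℤ.+ C) ℤ.- (S ℤ.+ T) ℤ.+ + 1 ℤ.+ + 1 ≡
                          (A ℤ.- S ℤ.+ + 1) ℤ.+ (B ℤ.- T ℤ.+ + 1) ℤ.+ C
  regroup = solve-∀

genusInduced-1 : ∀ m → genusInduced m 1 ≡ + 0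
genusInduced-1 m = cong (λ x → + x ℤ.- + 1 ℤ.+ + 1) (ℕP.*-zeroʳ m)

module _ {m : ℕ} {D : Divisor n} (D-break : IsBreak m n D) where
  open IsBreak D-break

  sumOver+genus∁≤genusK : (S : Subset n) → 0 < ∣ ∁ S ∣ →
                          sumOver S D ℤ.+ genusInduced m ∣ ∁ S ∣ ℤ.≤ genusK m n
  sumOver+genus∁≤genusK S 0<∣∁S∣ = begin
    sumOver S D ℤ.+ genusInduced m ∣ ∁ S ∣ ≤⟨ ℤP.+-monoʳ-≤ (sumOver S D) (induced (∁ S) (0<∣p∣⇒Nonempty 0<∣∁S∣)) ⟩
    sumOver S D ℤ.+ sumOver (∁ S) D        ≡⟨ sumOver-∁ S D ⟩
    total D                                ≡⟨ degree ⟩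
    genusK m n                             ∎
    where open ℤP.≤-Reasoning

IsBreak⇒entry< : {m : ℕ} {D : Divisor (suc n)} → IsBreak m (suc n) D → 0 < n →
                 ∀ i → D i ℤ.< + (m ℕ.* n)
IsBreak⇒entry< {n} {m} {D} D-break 0<n i = ℤP.suc[i]≤j⇒i<j (+-cancelˡ-≤ (genusInduced m n) (begin
  genusInduced m n ℤ.+ (+ 1 ℤ.+ D i)            ≡⟨ regroup (genusInduced m n) (D i) ⟩
  D i ℤ.+ genusInduced m n ℤ.+ + 1              ≡⟨ cong₂ (λ x k → x ℤ.+ genusInduced m k ℤ.+ + 1) (sumOver-⁅⁆ i D) ∣∁⁅i⁆∣ ⟨
  sumOver ⁅ i ⁆ D ℤ.+ genusInduced m ∣ ∁ ⁅ i ⁆ ∣ ℤ.+ + 1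
    ≤⟨ ℤP.+-monoˡ-≤ (+ 1) (sumOver+genus∁≤genusK D-break ⁅ i ⁆ (subst (0 <_) (sym ∣∁⁅i⁆∣) 0<n)) ⟩
  genusInduced m (1 ℕ.+ n) ℤ.+ + 1              ≡⟨ genusInduced-+ m 1 n ⟩
  genusInduced m 1 ℤ.+ genusInduced m n ℤ.+ + (m ℕ.* (1 ℕ.* n))
    ≡⟨ cong₂ (λ g k → g ℤ.+ genusInduced m n ℤ.+ + (m ℕ.* k)) (genusInduced-1 m) (ℕP.*-identityˡ n) ⟩
  + 0 ℤ.+ genusInduced m n ℤ.+ + (m ℕ.* n)      ≡⟨ cong (ℤ._+ + (m ℕ.* n)) (ℤP.+-identityˡ (genusInduced m n)) ⟩
  genusInduced m n ℤ.+ + (m ℕ.* n)              ∎))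
  where
  open ℤP.≤-Reasoning
  ∣∁⁅i⁆∣ : ∣ ∁ ⁅ i ⁆ ∣ ≡ n
  ∣∁⁅i⁆∣ = trans (∣∁p∣≡n∸∣p∣ ⁅ i ⁆) (cong (suc n ℕ.∸_) (∣⁅x⁆∣≡1 i))
  regroup : ∀ g d → g ℤ.+ (+ 1 ℤ.+ d) ≡ d ℤ.+ g ℤ.+ + 1
  regroup = solve-∀

module _ (m n : ℕ) .{{_ : NonZero m}} .{{_ : NonZero n}} where
  private instance
    N≢0 : NonZero (m ℕ.* n)
    N≢0 = ℕP.m*n≢0 m n

  shiftIter≡% : ∀ j (x : Fin n → ℕ) {k} → x k < m ℕ.* n →
                shiftIter m n j x k ≡ (x k ℕ.+ j ℕ.* m) % (m ℕ.* n)
  shiftIter≡% zero    x {k} xk<N = begin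
    x k                      ≡⟨ m<n⇒m%n≡m xk<N ⟨
    x k % (m ℕ.* n)          ≡⟨ cong (_% (m ℕ.* n)) (ℕP.+-identityʳ (x k)) ⟨
    (x k ℕ.+ 0) % (m ℕ.* n)  ∎
    where open ≡-Reasoning
  shiftIter≡% (suc j) x {k} xk<N = begin
    (shiftIter m n j x k ℕ.+ m) % (m ℕ.* n)                 ≡⟨ cong (λ y → (y ℕ.+ m) % (m ℕ.* n)) (shiftIter≡% j x xk<N) ⟩
    ((x k ℕ.+ j ℕ.* m) % (m ℕ.* n) ℕ.+ m) % (m ℕ.* n)       ≡⟨ [m%d+n]%d≡[m+n]%d (x k ℕ.+ j ℕ.* m) m (m ℕ.* n) ⟩
    (x k ℕ.+ j ℕ.* m ℕ.+ m) % (m ℕ.* n)                     ≡⟨ cong (_% (m ℕ.* n)) (regroup (x k) (j ℕ.* m) m) ⟩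
    (x k ℕ.+ (m ℕ.+ j ℕ.* m)) % (m ℕ.* n)                   ∎
    where
    open ≡-Reasoning
    regroup : ∀ a b c → a ℕ.+ b ℕ.+ c ≡ a ℕ.+ (c ℕ.+ b)
    regroup = ℕ-Ring.solve-∀

module _ {m n : ℕ} .{{_ : NonZero m}} .{{_ : NonZero n}}
         {x : Fin n → ℕ} (x-partition : IsPartition x) (x-break : IsBreak m n (toDivisor x))
         (x<N : ∀ k → x k < m ℕ.* n) (p : Fin n) (1+p<n : suc (toℕ p) < n) where
  private
    instance
      N≢0 : NonZero (m ℕ.* n)
      N≢0 = ℕP.m*n≢0 m n

    N t j c : ℕ
    N = m ℕ.* n
    t = toℕ p
    j = suc t
    c = j ℕ.* m

    z : Fin n → ℕ
    z = shiftIter m n j x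

    X Z : Divisor n
    X = toDivisor x
    Z = toDivisor z

    c<N : c < N
    c<N = subst (c <_) (ℕP.*-comm n m) (ℕP.*-monoˡ-< m 1+p<n)

    x+c<2N : ∀ k → x k ℕ.+ c < N ℕ.+ N
    x+c<2N k = ℕP.+-mono-< (x<N k) c<N

    z≡% : ∀ k → z k ≡ (x k ℕ.+ c) % N
    z≡% k = shiftIter≡% m n j x (x<N k)

    z-unwrapped : ∀ {k} → x k ℕ.+ c < N → z k ≡ x k ℕ.+ c
    z-unwrapped {k} x+c<N = trans (z≡% k) (m<n⇒m%n≡m x+c<N)

    z-wrapped : ∀ {k} → N ≤ x k ℕ.+ c → z k ℕ.+ N ≡ x k ℕ.+ c
    z-wrapped {k} N≤x+c = trans (cong (ℕ._+ N) (z≡% k)) (m%d+d≡m N≤x+c (x+c<2N k))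

    x+c≤z+N : ∀ k → x k ℕ.+ c ≤ z k ℕ.+ N
    x+c≤z+N k = subst (λ y → x k ℕ.+ c ≤ y ℕ.+ N) (sym (z≡% k)) (m≤m%d+d {d = N} (x+c<2N k))

    sumOver-+ℕ : (S : Subset n) (D : Divisor n) (a : ℕ) →
                 sumOver S (λ k → D k ℤ.+ + a) ≡ sumOver S D ℤ.+ + (∣ S ∣ ℕ.* a)
    sumOver-+ℕ S D a = trans (sumOver-+-const S D (+ a)) (cong (ℤ._+_ (sumOver S D)) (sym (ℤP.pos-* ∣ S ∣ a)))

    tN+N≡∣S∣c+∣∁S∣c : (S : Subset n) → t ℕ.* N ℕ.+ N ≡ ∣ S ∣ ℕ.* c ℕ.+ ∣ ∁ S ∣ ℕ.* c
    tN+N≡∣S∣c+∣∁S∣c S = begin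
      t ℕ.* (m ℕ.* n) ℕ.+ m ℕ.* n       ≡⟨ regroup t n m ⟩
      n ℕ.* c                           ≡⟨ cong (ℕ._* c) (∣p∣+∣∁p∣≡n S) ⟨
      (∣ S ∣ ℕ.+ ∣ ∁ S ∣) ℕ.* c         ≡⟨ ℕP.*-distribʳ-+ c ∣ S ∣ ∣ ∁ S ∣ ⟩
      ∣ S ∣ ℕ.* c ℕ.+ ∣ ∁ S ∣ ℕ.* c     ∎
      where
      open ≡-Reasoning
      regroup : ∀ t n m → t ℕ.* (m ℕ.* n) ℕ.+ m ℕ.* n ≡ n ℕ.* (suc t ℕ.* m)
      regroup = ℕ-Ring.solve-∀

  pivot-unwrapped⇒total< : x p ℕ.+ c < N → total X ℤ.< total Z
  pivot-unwrapped⇒total< x[p]+c<N = begin-strict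
    total X              ≡⟨ ℤP.+-identityʳ (total X) ⟨
    total X ℤ.+ + 0      <⟨ ℤP.+-monoʳ-< (total X) (ℤ.+<+ (ℕ.>-nonZero⁻¹ N)) ⟩
    total X ℤ.+ + N      ≤⟨ +-cancelˡ-≤ (+ (t ℕ.* N)) sum-bound ⟩
    total Z              ∎
    where
    open ℤP.≤-Reasoning
    A B : Subset n
    A = prefix t
    B = ∁ A

    unwrapped-on-B : ∀ {k} → k ∈ B → X k ℤ.+ + c ≡ Z k
    unwrapped-on-B {k} k∈B = cong +_ (sym (z-unwrapped
      (ℕP.≤-<-trans (ℕP.+-monoˡ-≤ c (x-partition p k (∈∁prefix⇒≥ k∈B))) x[p]+c<N)))

    sum-bound : + (t ℕ.* N) ℤ.+ (total X ℤ.+ + N) ℤ.≤ + (t ℕ.* N) ℤ.+ total Z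
    sum-bound = begin
      + (t ℕ.* N) ℤ.+ (total X ℤ.+ + N)
        ≡⟨ x∙yz≈y∙xz (+ (t ℕ.* N)) (total X) (+ N) ⟩
      total X ℤ.+ + (t ℕ.* N ℕ.+ N)
        ≡⟨ cong₂ ℤ._+_ (sumOver-∁ A X) (cong +_ (sym (tN+N≡∣S∣c+∣∁S∣c A))) ⟨
      sumOver A X ℤ.+ sumOver B X ℤ.+ (+ (∣ A ∣ ℕ.* c) ℤ.+ + (∣ B ∣ ℕ.* c))
        ≡⟨ interchange (sumOver A X) (sumOver B X) _ _ ⟩
      (sumOver A X ℤ.+ + (∣ A ∣ ℕ.* c)) ℤ.+ (sumOver B X ℤ.+ + (∣ B ∣ ℕ.* c))
        ≡⟨ cong₂ ℤ._+_ (sumOver-+ℕ A X c) (sumOver-+ℕ B X c) ⟨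
      sumOver A (λ k → X k ℤ.+ + c) ℤ.+ sumOver B (λ k → X k ℤ.+ + c)
        ≤⟨ ℤP.+-mono-≤ (sumOver-mono A (λ {k} _ → ℤ.+≤+ (x+c≤z+N k))) (ℤP.≤-reflexive (sumOver-cong B unwrapped-on-B)) ⟩
      sumOver A (λ k → Z k ℤ.+ + N) ℤ.+ sumOver B Z
        ≡⟨ cong (ℤ._+ sumOver B Z) (sumOver-+ℕ A Z N) ⟩
      sumOver A Z ℤ.+ + (∣ A ∣ ℕ.* N) ℤ.+ sumOver B Z
        ≡⟨ xy∙z≈y∙xz (sumOver A Z) _ (sumOver B Z) ⟩
      + (∣ A ∣ ℕ.* N) ℤ.+ (sumOver A Z ℤ.+ sumOver B Z)
        ≡⟨ cong₂ (λ a s → + (a ℕ.* N) ℤ.+ s) (∣prefix∣ t (ℕP.<⇒≤ (toℕ<n p))) (sumOver-∁ A Z) ⟩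
      + (t ℕ.* N) ℤ.+ total Z ∎

  pivot-wrapped⇒sumOver-prefix< : N ≤ x p ℕ.+ c → sumOver (prefix j) Z ℤ.< genusInduced m j
  pivot-wrapped⇒sumOver-prefix< N≤x[p]+c =
    ℤP.suc[i]≤j⇒i<j (+-cancelˡ-≤ (genusInduced m a ℤ.+ + (j ℕ.* N)) (begin
      genusInduced m a ℤ.+ + (j ℕ.* N) ℤ.+ (+ 1 ℤ.+ sumOver A Z)
        ≡⟨ regroup₁ (genusInduced m a) (+ (j ℕ.* N)) (sumOver A Z) ⟩
      sumOver A Z ℤ.+ + (j ℕ.* N) ℤ.+ genusInduced m a ℤ.+ + 1
        ≡⟨ cong (λ s → s ℤ.+ genusInduced m a ℤ.+ + 1) wrapped-sum ⟩
      sumOver A X ℤ.+ + (j ℕ.* c) ℤ.+ genusInduced m a ℤ.+ + 1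
        ≡⟨ regroup₂ (sumOver A X) (+ (j ℕ.* c)) (genusInduced m a) ⟩
      sumOver A X ℤ.+ genusInduced m a ℤ.+ + 1 ℤ.+ + (j ℕ.* c)
        ≤⟨ ℤP.+-monoˡ-≤ (+ (j ℕ.* c)) (ℤP.+-monoˡ-≤ (+ 1) (sumOver+genus∁≤genusK x-break A 0<a)) ⟩
      genusInduced m n ℤ.+ + 1 ℤ.+ + (j ℕ.* c)
        ≡⟨ cong (λ k → genusInduced m k ℤ.+ + 1 ℤ.+ + (j ℕ.* c)) a+j≡n ⟨
      genusInduced m (a ℕ.+ j) ℤ.+ + 1 ℤ.+ + (j ℕ.* c)
        ≡⟨ cong (ℤ._+ + (j ℕ.* c)) (genusInduced-+ m a j) ⟩
      genusInduced m a ℤ.+ genusInduced m j ℤ.+ + (m ℕ.* (a ℕ.* j)) ℤ.+ + (j ℕ.* c)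
        ≡⟨ regroup₃ (genusInduced m a) (genusInduced m j) (+ (m ℕ.* (a ℕ.* j))) (+ (j ℕ.* c)) ⟩
      genusInduced m a ℤ.+ + (m ℕ.* (a ℕ.* j) ℕ.+ j ℕ.* c) ℤ.+ genusInduced m j
        ≡⟨ cong (λ s → genusInduced m a ℤ.+ + s ℤ.+ genusInduced m j) maj+jc≡jN ⟩
      genusInduced m a ℤ.+ + (j ℕ.* N) ℤ.+ genusInduced m j ∎))
    where
    open ℤP.≤-Reasoning
    A : Subset n
    A = prefix j
    a : ℕ
    a = ∣ ∁ A ∣

    ∣A∣≡j : ∣ A ∣ ≡ j
    ∣A∣≡j = ∣prefix∣ j (ℕP.<⇒≤ 1+p<n)

    a+j≡n : a ℕ.+ j ≡ n
    a+j≡n = trans (ℕP.+-comm a j) (subst (λ s → s ℕ.+ a ≡ n) ∣A∣≡j (∣p∣+∣∁p∣≡n A))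

    0<a : 0 < a
    0<a = subst (0 <_) (sym (∣∁p∣≡n∸∣p∣ A)) (ℕP.m<n⇒0<n∸m (subst (_< n) (sym ∣A∣≡j) 1+p<n))

    maj+jc≡jN : m ℕ.* (a ℕ.* j) ℕ.+ j ℕ.* c ≡ j ℕ.* N
    maj+jc≡jN = trans (ring m a j) (cong (λ k → j ℕ.* (m ℕ.* k)) a+j≡n)
      where
      ring : ∀ m a j → m ℕ.* (a ℕ.* j) ℕ.+ j ℕ.* (j ℕ.* m) ≡ j ℕ.* (m ℕ.* (a ℕ.+ j))
      ring = ℕ-Ring.solve-∀

    wrapped-on-A : ∀ {k} → k ∈ A → Z k ℤ.+ + N ≡ X k ℤ.+ + c
    wrapped-on-A {k} k∈A = cong +_ (z-wrapped
      (ℕP.≤-trans N≤x[p]+c (ℕP.+-monoˡ-≤ c (x-partition k p (ℕ.s≤s⁻¹ (∈prefix⇒< k∈A))))))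

    wrapped-sum : sumOver A Z ℤ.+ + (j ℕ.* N) ≡ sumOver A X ℤ.+ + (j ℕ.* c)
    wrapped-sum = begin-equality
      sumOver A Z ℤ.+ + (j ℕ.* N)      ≡⟨ cong (λ s → sumOver A Z ℤ.+ + (s ℕ.* N)) ∣A∣≡j ⟨
      sumOver A Z ℤ.+ + (∣ A ∣ ℕ.* N)  ≡⟨ sumOver-+ℕ A Z N ⟨
      sumOver A (λ k → Z k ℤ.+ + N)    ≡⟨ sumOver-cong A wrapped-on-A ⟩
      sumOver A (λ k → X k ℤ.+ + c)    ≡⟨ sumOver-+ℕ A X c ⟩
      sumOver A X ℤ.+ + (∣ A ∣ ℕ.* c)  ≡⟨ cong (λ s → sumOver A X ℤ.+ + (s ℕ.* c)) ∣A∣≡j ⟩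
      sumOver A X ℤ.+ + (j ℕ.* c)      ∎

    regroup₁ : ∀ g w s → g ℤ.+ w ℤ.+ (+ 1 ℤ.+ s) ≡ s ℤ.+ w ℤ.+ g ℤ.+ + 1
    regroup₁ = solve-∀
    regroup₂ : ∀ s w g → s ℤ.+ w ℤ.+ g ℤ.+ + 1 ≡ s ℤ.+ g ℤ.+ + 1 ℤ.+ w
    regroup₂ = solve-∀
    regroup₃ : ∀ g h u v → g ℤ.+ h ℤ.+ u ℤ.+ v ≡ g ℤ.+ (u ℤ.+ v) ℤ.+ h
    regroup₃ = solve-∀

  shiftIter-¬IsBreak : ¬ IsBreak m n Z
  shiftIter-¬IsBreak Z-break with x p ℕ.+ c ℕ.<? N
  ... | yes x[p]+c<N = ℤP.<-irrefl (trans (IsBreak.degree x-break) (sym (IsBreak.degree Z-break)))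
                                   (pivot-unwrapped⇒total< x[p]+c<N)
  ... | no  x[p]+c≮N = ℤP.<⇒≱ (pivot-wrapped⇒sumOver-prefix< (ℕP.≮⇒≥ x[p]+c≮N))
                         (subst (λ s → sumOver (prefix j) Z ℤ.≥ genusInduced m s) (∣prefix∣ j (ℕP.<⇒≤ 1+p<n))
                           (IsBreak.induced Z-break (prefix j) (p , <⇒∈prefix (ℕP.n<1+n t))))

lemma3p5 : (m n : ℕ) → .{{_ : NonZero m}} → .{{_ : NonZero n}} →
    (lam : Fin n → ℕ) → IsPartition lam → IsBreak m n (toDivisor lam) →
    (j : ℕ) → 1 ≤ j → j < n →
    (y : Fin n → ℕ) → IsSortOf y (shiftIter m n j lam) →
    ¬ (IsPartition y × IsBreak m n (toDivisor y))
lemma3p5 m zero    _   _             _         _        _ ()  _ _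
lemma3p5 m (suc n) lam lam-partition lam-break (suc j′) _ j<n y (_ , σ , y≡z) (_ , y-break) =
  subst (λ i → ¬ IsBreak m (suc n) (toDivisor (shiftIter m (suc n) (suc i) lam))) (toℕ-fromℕ< j′<n)
    (shiftIter-¬IsBreak lam-partition lam-break lam<N p 1+p<n)
    (IsBreak-rearrange σ (cong +_ ∘ y≡z) y-break)
  where
  j′<n : j′ < suc n
  j′<n = ℕP.<-trans (ℕP.n<1+n j′) j<n
  p : Fin (suc n)
  p = fromℕ< j′<n
  1+p<n : suc (toℕ p) < suc n
  1+p<n = subst (λ i → suc i < suc n) (sym (toℕ-fromℕ< j′<n)) j<n
  lam<N : ∀ k → lam k < m ℕ.* suc n
  lam<N k = ℕP.<-≤-trans (ℤP.drop‿+<+ (IsBreak⇒entry< lam-break (ℕP.<-≤-trans ℕ.z<s (ℕ.s≤s⁻¹ j<n)) k))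
                         (ℕP.*-monoʳ-≤ m (ℕP.n≤1+n n))
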